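{- Let $d\ge2$ and $a\ge1$ be integers, let $m=\lfloor\log_da\rfloor$, and let $a=\sum_{i=0}^m a_id^i$ be the base-$d$ expansion of $a$ ($0\le a_i\le d-1$). Then $$\Big(\log_da-\frac{2d-1}{d-1}\Big)a<\Big(m-\frac d{d-1}\Big)a<\sum_{i=0}^m i\,a_id^i\le ma.$$ -}

module Defs where

open import Data.Nat using (ℕ; zero; suc; _+_)
open import Data.Fin using (Fin; zero; suc)

Σ< : (n : ℕ) → (Fin n → ℕ) → ℕ
Σ< zero    f = 0
Σ< (suc n) f = f zero + Σ< n (λ i → f (suc i))

module Submission where

-- Write a = Σ_{i ≤ m} t_i with t_i = a_i d^i, let S = Σ i t_i be the
-- digit-weighted sum of the theorem and T = Σ (m - i) t_i its "co-weighted" twin.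
-- Since i + (m - i) = m for i ≤ m, we have S + T = m a, which gives S ≤ m a at once.
-- For the lower bound it suffices that (d-1) T < d^(m+1) ≤ d a.  Because every
-- digit is at most d-1, (d-1) T is bounded by (d-1)^2 Σ (m - i) d^i, and the closed
-- form of that sum yields the sharper inequality
--     (d-1) T + (m+1) d ≤ d^(m+1) + m,
-- which (unlike the bare strict bound) is strong enough to be proved by induction on m.

open import Defs
open import Data.Nat using (ℕ; zero; suc; _+_; _*_; _∸_; _^_; _≤_; _<_; s≤s; z≤n)
open import Data.Nat.Properties
open import Data.Nat.Tactic.RingSolver using (solve-∀)
open import Data.Fin using (Fin; toℕ; zero; suc)
open import Data.Fin.Properties using (toℕ<n)
open import Data.Product using (_×_; _,_)
open import Relation.Binary.PropositionalEquality

Σ<-cong : ∀ n {f g : Fin n → ℕ} → (∀ i → f i ≡ g i) → Σ< n f ≡ Σ< n g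
Σ<-cong zero    f≡g = refl
Σ<-cong (suc n) f≡g = cong₂ _+_ (f≡g zero) (Σ<-cong n (λ i → f≡g (suc i)))

Σ<-scale : ∀ n c (f : Fin n → ℕ) → Σ< n (λ i → c * f i) ≡ c * Σ< n f
Σ<-scale zero    c f = sym (*-zeroʳ c)
Σ<-scale (suc n) c f = begin
  c * f zero + Σ< n (λ i → c * f (suc i)) ≡⟨ cong (c * f zero +_) (Σ<-scale n c (λ i → f (suc i))) ⟩
  c * f zero + c * Σ< n (λ i → f (suc i)) ≡⟨ *-distribˡ-+ c (f zero) _ ⟨
  c * Σ< (suc n) f                        ∎
  where open ≡-Reasoning

Σ<-+ : ∀ n (f g : Fin n → ℕ) → Σ< n (λ i → f i + g i) ≡ Σ< n f + Σ< n g
Σ<-+ zero    f g = refl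
Σ<-+ (suc n) f g = begin
  f zero + g zero + Σ< n (λ i → f (suc i) + g (suc i))
    ≡⟨ cong (f zero + g zero +_) (Σ<-+ n (λ i → f (suc i)) (λ i → g (suc i))) ⟩
  f zero + g zero + (Σ< n (λ i → f (suc i)) + Σ< n (λ i → g (suc i)))
    ≡⟨ interchange (f zero) (g zero) _ _ ⟩
  Σ< (suc n) f + Σ< (suc n) g ∎
  where
  open ≡-Reasoning
  interchange : ∀ w x y z → w + x + (y + z) ≡ w + y + (x + z)
  interchange = solve-∀

weighted coweighted : (m : ℕ) → (Fin (suc m) → ℕ) → ℕ
weighted   m f = Σ< (suc m) (λ i → toℕ i * f i)
coweighted m f = Σ< (suc m) (λ i → (m ∸ toℕ i) * f i)

-- Since i + (m - i) = m, the two weightings add up to m times the plain sum.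
weight-split : ∀ m (f : Fin (suc m) → ℕ) →
               weighted m f + coweighted m f ≡ m * Σ< (suc m) f
weight-split m f = begin
  weighted m f + coweighted m f
    ≡⟨ Σ<-+ (suc m) (λ i → toℕ i * f i) (λ i → (m ∸ toℕ i) * f i) ⟨
  Σ< (suc m) (λ i → toℕ i * f i + (m ∸ toℕ i) * f i)
    ≡⟨ Σ<-cong (suc m) (λ i → weights-add-up i (f i)) ⟩
  Σ< (suc m) (λ i → m * f i)
    ≡⟨ Σ<-scale (suc m) m f ⟩
  m * Σ< (suc m) f ∎
  where
  open ≡-Reasoning
  weights-add-up : ∀ (i : Fin (suc m)) x → toℕ i * x + (m ∸ toℕ i) * x ≡ m * x
  weights-add-up i x = trans (sym (*-distribʳ-+ x (toℕ i) (m ∸ toℕ i)))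
                             (cong (_* x) (m+[n∸m]≡n (≤-pred (toℕ<n i))))

terms : (d : ℕ) → ∀ {n} → (Fin n → ℕ) → Fin n → ℕ
terms d digits i = digits i * d ^ toℕ i

-- Dropping the lowest digit divides every remaining term by d.
coweighted-shift : ∀ d m (digits : Fin (suc (suc m)) → ℕ) →
                   coweighted m (λ i → terms d digits (suc i))
                   ≡ d * coweighted m (terms d (λ i → digits (suc i)))
coweighted-shift d m digits = trans
  (Σ<-cong (suc m) (λ i → regroup (m ∸ toℕ i) (digits (suc i)) d (d ^ toℕ i)))
  (Σ<-scale (suc m) d (λ i → (m ∸ toℕ i) * terms d (λ j → digits (suc j)) i))
  where
  regroup : ∀ w x d y → w * (x * (d * y)) ≡ d * (w * (x * y))
  regroup = solve-∀

-- Co-weight bound: with digits at most e in base d = e + 1,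
--   e · Σ (m - i) a_i d^i + (m + 1) d ≤ d^(m+1) + m,
-- a consequence of the closed form (d-1)^2 Σ_{i ≤ m} (m - i) d^i = d^(m+1) - (m+1)(d-1) - 1.
coweight-bound : ∀ e m (digits : Fin (suc m) → ℕ) → (∀ i → digits i ≤ e) →
                 e * coweighted m (terms (suc e) digits) + suc m * suc e ≤ suc e ^ suc m + m
coweight-bound e zero    digits _     = ≤-reflexive (base e)
  where
  base : ∀ e → e * 0 + 1 * suc e ≡ suc e * 1 + 0
  base = solve-∀
coweight-bound e (suc m) digits small = +-cancelʳ-≤ (suc m * d * d) _ _ (begin
  e * (suc m * (a₀ * 1) + coweighted m (λ i → terms d digits (suc i))) + suc (suc m) * d + suc m * d * d
    ≡⟨ cong (λ z → e * (suc m * (a₀ * 1) + z) + suc (suc m) * d + suc m * d * d)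
            (coweighted-shift d m digits) ⟩
  e * (suc m * (a₀ * 1) + d * U) + suc (suc m) * d + suc m * d * d
    ≡⟨ unfold e m a₀ U ⟩
  e * (suc m * a₀) + d * (e * U + suc m * d) + suc (suc m) * d
    ≤⟨ +-monoˡ-≤ (suc (suc m) * d)
         (+-mono-≤ (*-monoʳ-≤ e (*-monoʳ-≤ (suc m) (small zero)))
                   (*-monoʳ-≤ d (coweight-bound e m (λ i → digits (suc i)) (λ i → small (suc i))))) ⟩
  e * (suc m * e) + d * (d ^ suc m + m) + suc (suc m) * d
    ≡⟨ refold e m (d ^ suc m) ⟩
  d * d ^ suc m + suc m + suc m * d * d ∎)
  where
  open ≤-Reasoning
  d  = suc e
  a₀ = digits zero
  U  = coweighted m (terms d (λ i → digits (suc i)))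
  unfold : ∀ e m x u → e * (suc m * (x * 1) + suc e * u) + suc (suc m) * suc e + suc m * suc e * suc e
                       ≡ e * (suc m * x) + suc e * (e * u + suc m * suc e) + suc (suc m) * suc e
  unfold = solve-∀
  refold : ∀ e m p → e * (suc m * e) + suc e * (p + m) + suc (suc m) * suc e
                     ≡ suc e * p + suc m + suc m * suc e * suc e
  refold = solve-∀

coweight-< : ∀ e m (digits : Fin (suc m) → ℕ) → (∀ i → digits i ≤ e) →
             e * coweighted m (terms (suc e) digits) < suc e ^ suc m
coweight-< e m digits small = +-cancelʳ-≤ m _ _ (begin
  suc (e * T) + m      ≡⟨ +-suc (e * T) m ⟨
  e * T + suc m        ≤⟨ +-monoʳ-≤ (e * T) (m≤m*n (suc m) (suc e)) ⟩
  e * T + suc m * suc e ≤⟨ coweight-bound e m digits small ⟩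
  suc e ^ suc m + m    ∎)
  where
  open ≤-Reasoning
  T = coweighted m (terms (suc e) digits)

lemma6 : (d a m : ℕ) → 2 ≤ d → 1 ≤ a → d ^ m ≤ a → a < d ^ suc m →
    (digits : Fin (suc m) → ℕ) → (∀ i → digits i < d) →
    a ≡ Σ< (suc m) (λ i → digits i * d ^ toℕ i) →
    (a < d ^ suc m)
    × (m * (d ∸ 1) * a < (d ∸ 1) * Σ< (suc m) (λ i → toℕ i * digits i * d ^ toℕ i) + d * a)
    × (Σ< (suc m) (λ i → toℕ i * digits i * d ^ toℕ i) ≤ m * a)
lemma6 (suc (suc k)) a m (s≤s (s≤s z≤n)) _ dᵐ≤a a<dᵐ⁺¹ digits digit<d a≡Σ =
  a<dᵐ⁺¹ , lower , upper
  where
  e = suc k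
  d = suc e
  S = weighted m (terms d digits)
  T = coweighted m (terms d digits)
  S≡ : Σ< (suc m) (λ i → toℕ i * digits i * d ^ toℕ i) ≡ S
  S≡ = Σ<-cong (suc m) (λ i → *-assoc (toℕ i) (digits i) (d ^ toℕ i))
  S+T≡ma : S + T ≡ m * a
  S+T≡ma = trans (weight-split m (terms d digits)) (cong (m *_) (sym a≡Σ))
  eT<da : e * T < d * a
  eT<da = <-≤-trans (coweight-< e m digits (λ i → ≤-pred (digit<d i))) (*-monoʳ-≤ d dᵐ≤a)
  upper : Σ< (suc m) (λ i → toℕ i * digits i * d ^ toℕ i) ≤ m * a
  upper rewrite S≡ = ≤-trans (m≤m+n S T) (≤-reflexive S+T≡ma)
  lower : m * e * a < e * Σ< (suc m) (λ i → toℕ i * digits i * d ^ toℕ i) + d * a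
  lower rewrite S≡ = begin-strict
    m * e * a   ≡⟨ cong (_* a) (*-comm m e) ⟩
    e * m * a   ≡⟨ *-assoc e m a ⟩
    e * (m * a) ≡⟨ cong (e *_) S+T≡ma ⟨
    e * (S + T) ≡⟨ *-distribˡ-+ e S T ⟩
    e * S + e * T <⟨ +-monoʳ-< (e * S) eT<da ⟩
    e * S + d * a ∎
    where open ≤-Reasoning
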